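{- Fix $n \ge 3$ and let $\pi \in \mathcal{P}_n(132)$. Then: (i) $\pi^{ -1}(n) = 1$, $\pi^{ -1}(n) = 2$, or $\pi^{ -1}(n) = n$ (i.e. the entry $n$ is in position $1$, $2$, or $n$). (ii) The map $\sigma \mapsto n,\sigma$ (prepend $n$) is a bijection from $\mathcal{P}_{n-1}(132)$ onto the set of permutations in $\mathcal{P}_n(132)$ which begin with $n$. (iii) The map $\sigma \mapsto n-1, n, \sigma$ (prepend $n-1$ and then $n$) is a bijection from $\mathcal{P}_{n-2}(132)$ onto the set of permutations in $\mathcal{P}_n(132)$ whose second entry is $n$. (iv) The map $\sigma \mapsto \sigma, n$ (append $n$) is a bijection from $\mathcal{P}_{n-1}(132)$ onto the set of permutations in $\mathcal{P}_n(132)$ which end with $n$.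
   Context: Permutations are written in one-line notation; $S_n$ is the set of permutations of $\{1,\dots,n\}$. A permutation $\pi\in S_n$ contains a pattern $\sigma\in S_k$ if there are indices $i_1<\dots<i_k$ such that $\pi(i_a)<\pi(i_b)$ iff $\sigma(a)<\sigma(b)$ for all $a,b$; otherwise $\pi$ avoids $\sigma$. For a set $R$ of patterns, $S_n(R)$ is the set of permutations in $S_n$ avoiding every element of $R$. $\mathcal{P}_n(132)$ denotes the set of two-stack sortable permutations in $S_n$ that avoid $132$; equivalently, $\mathcal{P}_n(132)=S_n(132,2341,3241)$. $\mathcal{P}_0(132)$ consists of the empty permutation. -}

module Defs where

open import Data.Nat using (ℕ; suc; _<_)
open import Data.Fin using (Fin) renaming (_<_ to _<ᶠ_)
open import Data.List using (List; []; _∷_; length; lookup; map; upTo)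
open import Data.List.Relation.Binary.Permutation.Propositional using (_↭_)
open import Data.Product using (Σ; _×_)
open import Function.Bundles using (_⇔_)
open import Relation.Nullary using (¬_)
open import Relation.Binary.PropositionalEquality using (_≡_)

-- A permutation in one-line notation is a list of naturals.
-- π ∈ S_n  iff  π is a rearrangement of [1, 2, …, n].
IsPerm : ℕ → List ℕ → Set
IsPerm n π = π ↭ map suc (upTo n)

Contains : List ℕ → List ℕ → Set
Contains π σ =
  Σ (Fin (length σ) → Fin (length π)) λ f →
    (∀ a b → a <ᶠ b → f a <ᶠ f b) ×
    (∀ a b → (lookup π (f a) < lookup π (f b)) ⇔ (lookup σ a < lookup σ b))

Avoids : List ℕ → List ℕ → Set
Avoids π σ = ¬ Contains π σ

P132 : ℕ → List ℕ → Set
P132 n π =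
  IsPerm n π ×
  Avoids π (1 ∷ 3 ∷ 2 ∷ []) ×
  Avoids π (2 ∷ 3 ∷ 4 ∷ 1 ∷ []) ×
  Avoids π (3 ∷ 2 ∷ 4 ∷ 1 ∷ [])

BijOnto : (A B : List ℕ → Set) → (List ℕ → List ℕ) → Set
BijOnto A B g =
  (∀ x → A x → B (g x)) ×
  (∀ x y → A x → A y → g x ≡ g y → x ≡ y) ×
  (∀ y → B y → Σ (List ℕ) λ x → A x × g x ≡ y)

-- A new largest entry can only play the role of the largest letter of a pattern, and in
-- 132, 2341 and 3241 that letter is neither the first nor the last one. Hence prepending or
-- appending a maximum keeps a permutation in the class, and deleting entries always does.
-- Prepending n−1, n is safe too: an occurrence starting at n−1 would need a larger entry at
-- its third letter, but only n exceeds n−1. Conversely, n cannot have two entries x, y before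
-- it and an entry z after it: x n z or y n z is a 132, or z lies below x and y and x y n z is
-- a 2341 or a 3241. If n is the second entry, the first is n−1, since otherwise a n (n−1) is a 132.

module Submission where

open import Defs
open import Data.Nat using (ℕ; _<?_; _≟_; _+_; zero; suc; _≤_; _<_; _∸_; z≤n; s≤s; z<s; s<s)
open import Data.Nat.Properties using (<-irrefl; <-asym; <-trans; ≤∧≢⇒<; <-cmp; n≮0; ≤-refl; <⇒≤; <⇒≱; ≤-trans; suc-injective; ≤-pred; m≤n⇒m≤1+n)
open import Data.Fin using (Fin; zero; suc; toℕ) renaming (_<_ to _<ᶠ_; _≤_ to _≤ᶠ_)
import Data.Fin.Properties as Fin
open import Data.List using (List; []; _∷_; _++_; [_]; length; lookup; map; upTo; removeAt)
open import Data.List.Relation.Binary.Sublist.Propositional using (_⊆_; []; _∷_; _∷ʳ_; ⊆-refl; minimum; from∈)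
open import Data.List.Relation.Binary.Sublist.Propositional.Properties using (All-resp-⊆; ++⁺ˡ; ++⁺ʳ)
open import Data.List.Relation.Unary.All as All using (All; []; _∷_)
import Data.List.Relation.Unary.AllPairs as AllPairs
open import Data.List.Membership.Propositional using (_∈_)
open import Data.List.Relation.Unary.Any using (here; there)
open import Data.List.Membership.Propositional.Properties using (∈-lookup; ∈-map⁺; ∈-map⁻; ∈-upTo⁺; ∈-upTo⁻; ∈-∃++)
open import Data.List.Properties using (map-++; upTo-∷ʳ; ∷-injectiveʳ; ∷ʳ-injectiveˡ)
open import Data.List.Relation.Unary.Unique.Propositional using (Unique; []; _∷_)
open import Data.List.Relation.Unary.Unique.Propositional.Properties using (map⁺; upTo⁺)
open import Data.List.Relation.Binary.Permutation.Propositional using (_↭_; ↭-refl; ↭-prep; ↭-swap; ↭-trans; ↭-sym; ↭⇒↭ₛ)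
open import Data.List.Relation.Binary.Permutation.Propositional.Properties using (∈-resp-↭; drop-∷; ∷↭∷ʳ)
open import Data.Product using (Σ; _×_; _,_)
open import Data.Sum using (_⊎_; inj₁; inj₂)
open import Data.Empty using (⊥; ⊥-elim)
open import Function using (_∘_; case_of_)
open import Function.Bundles using (_⇔_; mk⇔; Equivalence)
open import Relation.Binary using (Tri; tri<; tri≈; tri>)
open import Relation.Nullary using (¬_; yes; no; contradiction)
open import Relation.Nullary.Decidable using (True; False; toWitness; toWitnessFalse; from-yes)
open import Relation.Binary.PropositionalEquality using (_≡_; _≢_; refl; sym; cong; subst; subst₂; trans; setoid)
open import Data.List.Relation.Binary.Permutation.Setoid.Properties (setoid ℕ) using (Unique-resp-↭)

private
  variable
    m n x y q : ℕ
    xs ys σ π p qs : List ℕ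

⊆-index : xs ⊆ ys → Fin (length xs) → Fin (length ys)
⊆-index (y ∷ʳ τ) i       = suc (⊆-index τ i)
⊆-index (refl ∷ τ) zero    = zero
⊆-index (refl ∷ τ) (suc i) = suc (⊆-index τ i)

⊆-index-mono : (τ : xs ⊆ ys) → ∀ {i j} → i <ᶠ j → ⊆-index τ i <ᶠ ⊆-index τ j
⊆-index-mono (y ∷ʳ τ) i<j                         = s<s (⊆-index-mono τ i<j)
⊆-index-mono (refl ∷ τ) {zero}  {suc j} _         = z<s
⊆-index-mono (refl ∷ τ) {suc i} {suc j} (s<s i<j) = s<s (⊆-index-mono τ i<j)

lookup-⊆-index : (τ : xs ⊆ ys) → ∀ i → lookup ys (⊆-index τ i) ≡ lookup xs i
lookup-⊆-index (y ∷ʳ τ)   i       = lookup-⊆-index τ i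
lookup-⊆-index (refl ∷ τ) zero    = refl
lookup-⊆-index (refl ∷ τ) (suc i) = lookup-⊆-index τ i

Contains-⊆ : σ ⊆ π → Contains σ p → Contains π p
Contains-⊆ {p = p} τ (f , mono , iso) =
  ⊆-index τ ∘ f , (λ a b → ⊆-index-mono τ ∘ mono a b) ,
  λ a b → subst₂ (λ u v → (u < v) ⇔ (lookup p a < lookup p b))
                 (sym (lookup-⊆-index τ (f a))) (sym (lookup-⊆-index τ (f b))) (iso a b)

Avoids-⊆ : σ ⊆ π → Avoids π p → Avoids σ p
Avoids-⊆ {p = p} τ π-avoids = π-avoids ∘ Contains-⊆ {p = p} τ

punchOutAt : ∀ {A : Set} (xs : List A) {k j : Fin (length xs)} → k ≢ j → Fin (length (removeAt xs k))
punchOutAt (x ∷ xs) {zero}  {zero}  k≢j = contradiction refl k≢j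
punchOutAt (x ∷ xs) {zero}  {suc j} _   = j
punchOutAt (x ∷ xs) {suc k} {zero}  _   = zero
punchOutAt (x ∷ xs) {suc k} {suc j} k≢j = suc (punchOutAt xs (k≢j ∘ cong suc))

lookup-punchOutAt : ∀ {A : Set} (xs : List A) {k j} (k≢j : k ≢ j) →
                    lookup (removeAt xs k) (punchOutAt xs k≢j) ≡ lookup xs j
lookup-punchOutAt (x ∷ xs) {zero}  {zero}  k≢j = contradiction refl k≢j
lookup-punchOutAt (x ∷ xs) {zero}  {suc j} _   = refl
lookup-punchOutAt (x ∷ xs) {suc k} {zero}  _   = refl
lookup-punchOutAt (x ∷ xs) {suc k} {suc j} k≢j = lookup-punchOutAt xs (k≢j ∘ cong suc)

punchOutAt-mono : ∀ {A : Set} (xs : List A) {k i j} (k≢i : k ≢ i) (k≢j : k ≢ j) →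
                  i <ᶠ j → punchOutAt xs k≢i <ᶠ punchOutAt xs k≢j
punchOutAt-mono (x ∷ xs) {zero}  {zero}          k≢i _   _         = contradiction refl k≢i
punchOutAt-mono (x ∷ xs) {zero}  {suc i} {suc j} _   _   (s<s i<j) = i<j
punchOutAt-mono (x ∷ xs) {suc k} {zero}  {suc j} _   _   _         = z<s
punchOutAt-mono (x ∷ xs) {suc k} {suc i} {suc j} k≢i k≢j (s<s i<j) =
  s<s (punchOutAt-mono xs (k≢i ∘ cong suc) (k≢j ∘ cong suc) i<j)

Contains-removeAt : ∀ {π p} {k : Fin (length π)} ((f , _ , _) : Contains π p) →
                    (∀ a → k ≢ f a) → Contains (removeAt π k) p
Contains-removeAt {π} {p} (f , mono , iso) k≢f =
  (λ a → punchOutAt π (k≢f a)) ,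
  (λ a b a<b → punchOutAt-mono π (k≢f a) (k≢f b) (mono a b a<b)) ,
  λ a b → subst₂ (λ u v → (u < v) ⇔ (lookup p a < lookup p b))
                 (sym (lookup-punchOutAt π (k≢f a))) (sym (lookup-punchOutAt π (k≢f b))) (iso a b)

lookup-≤-strict-max : ∀ {π} (k : Fin (length π)) → All (_< lookup π k) (removeAt π k) →
                      ∀ j → lookup π j ≤ lookup π k
lookup-≤-strict-max {π} k max j with k Fin.≟ j
... | yes refl = ≤-refl
... | no  k≢j  = <⇒≤ (subst (_< lookup π k) (lookup-punchOutAt π k≢j)
                               (All.lookup max (∈-lookup (punchOutAt π k≢j))))

strict-max-unused : ∀ {π p} (k : Fin (length π)) → All (_< lookup π k) (removeAt π k) →
                    ((f , _ , _) : Contains π p) → ∀ {a b} → lookup p a < lookup p b → k ≢ f a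
strict-max-unused {π} k max (f , _ , iso) {a} {b} pa<pb refl =
  <⇒≱ (Equivalence.from (iso a b) pa<pb) (lookup-≤-strict-max {π} k max (f b))

Contains-∷⁻ : ((f , _ , _) : Contains (x ∷ σ) (q ∷ qs)) → zero ≢ f zero → Contains σ (q ∷ qs)
Contains-∷⁻ {x} {σ} {q} {qs} c@(f , mono , _) 0≢f0 =
  Contains-removeAt {x ∷ σ} {q ∷ qs} c misses
  where
  misses : ∀ a → zero ≢ f a
  misses zero         = 0≢f0
  misses (suc a) 0≡fa = n≮0 (subst (λ i → toℕ (f zero) < toℕ i) (sym 0≡fa) (mono zero (suc a) z<s))

Avoids-∷-max : ∀ b → All (_< x) σ → q < lookup (q ∷ qs) b →
               Avoids σ (q ∷ qs) → Avoids (x ∷ σ) (q ∷ qs)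
Avoids-∷-max b σ<x q<qb σ-avoids c =
  σ-avoids (Contains-∷⁻ c (strict-max-unused zero σ<x c {b = b} q<qb))

Avoids-∷-max-but-next : ∀ (c b : Fin (length (q ∷ qs))) → All (_< x) σ →
                        0 < toℕ c → c <ᶠ b → q < lookup (q ∷ qs) b →
                        Avoids (y ∷ σ) (q ∷ qs) → Avoids (x ∷ y ∷ σ) (q ∷ qs)
Avoids-∷-max-but-next {x = x} {σ = σ} {y = y} c b σ<x 0<c c<b q<qb yσ-avoids occ@(f , mono , iso) =
  yσ-avoids (Contains-∷⁻ occ first-unused)
  where
  beyond-second : ∀ i → 1 < toℕ i → lookup (x ∷ y ∷ σ) i < x
  beyond-second (suc (suc j)) _ = All.lookup σ<x (∈-lookup j)
  beyond-second (suc zero) (s<s ())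
  -- The entry matched to b lies beyond y, as c sits between 0 and b, yet it must exceed x.
  first-unused : zero ≢ f zero
  first-unused 0≡f0 = <-asym x<fb (beyond-second (f b) (≤-trans (s≤s 0<fc) (mono c b c<b)))
    where
    0<fc : 0 < toℕ (f c)
    0<fc = subst (λ i → toℕ i < toℕ (f c)) (sym 0≡f0) (mono zero c 0<c)
    x<fb : x < lookup (x ∷ y ∷ σ) (f b)
    x<fb = subst (λ i → lookup (x ∷ y ∷ σ) i < lookup (x ∷ y ∷ σ) (f b)) (sym 0≡f0)
                 (Equivalence.from (iso zero b) q<qb)

lastIndex : ∀ {A : Set} (xs : List A) x → Fin (length (xs ++ [ x ]))
lastIndex []       x = zero
lastIndex (y ∷ xs) x = suc (lastIndex xs x)

lookup-lastIndex : ∀ {A : Set} (xs : List A) x → lookup (xs ++ [ x ]) (lastIndex xs x) ≡ x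
lookup-lastIndex []       x = refl
lookup-lastIndex (y ∷ xs) x = lookup-lastIndex xs x

removeAt-lastIndex : ∀ {A : Set} (xs : List A) x → removeAt (xs ++ [ x ]) (lastIndex xs x) ≡ xs
removeAt-lastIndex []       x = refl
removeAt-lastIndex (y ∷ xs) x = cong (y ∷_) (removeAt-lastIndex xs x)

≤-lastIndex : ∀ {A : Set} (xs : List A) x (i : Fin (length (xs ++ [ x ]))) → i ≤ᶠ lastIndex xs x
≤-lastIndex []       x zero    = z≤n
≤-lastIndex (y ∷ xs) x zero    = z≤n
≤-lastIndex (y ∷ xs) x (suc i) = s≤s (≤-lastIndex xs x i)

Contains-∷ʳ⁻ : ((f , _ , _) : Contains (σ ++ [ x ]) (qs ++ [ q ])) →
               lastIndex σ x ≢ f (lastIndex qs q) → Contains σ (qs ++ [ q ])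
Contains-∷ʳ⁻ {σ} {x} {qs} {q} occ@(f , mono , _) last≢f-last =
  subst (λ τ → Contains τ (qs ++ [ q ])) (removeAt-lastIndex σ x)
        (Contains-removeAt {σ ++ [ x ]} {qs ++ [ q ]} occ misses)
  where
  misses : ∀ a → lastIndex σ x ≢ f a
  misses a with a Fin.≟ lastIndex qs q
  ... | yes refl   = last≢f-last
  ... | no  a≢last = λ last≡fa →
    <⇒≱ (mono a (lastIndex qs q) (Fin.≤∧≢⇒< (≤-lastIndex qs q a) a≢last))
        (subst (λ i → toℕ (f (lastIndex qs q)) ≤ toℕ i) last≡fa (≤-lastIndex σ x _))

Avoids-∷ʳ-max : ∀ b → All (_< x) σ → q < lookup (qs ++ [ q ]) b →
                Avoids σ (qs ++ [ q ]) → Avoids (σ ++ [ x ]) (qs ++ [ q ])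
Avoids-∷ʳ-max {x} {σ} {q} {qs} b σ<x q<qb σ-avoids occ =
  σ-avoids (Contains-∷ʳ⁻ {σ} {x} {qs} {q} occ
    (strict-max-unused {σ ++ [ x ]} {qs ++ [ q ]} (lastIndex σ x) x-max occ {b = b} last<qb))
  where
  x-max : All (_< lookup (σ ++ [ x ]) (lastIndex σ x)) (removeAt (σ ++ [ x ]) (lastIndex σ x))
  x-max = subst₂ (λ v τ → All (_< v) τ) (sym (lookup-lastIndex σ x)) (sym (removeAt-lastIndex σ x)) σ<x
  last<qb : lookup (qs ++ [ q ]) (lastIndex qs q) < lookup (qs ++ [ q ]) b
  last<qb = subst (_< lookup (qs ++ [ q ]) b) (sym (lookup-lastIndex qs q)) q<qb

agree : ∀ {A : Set} {m n} → A → {_ : True (m <? n)} → A ⇔ (m < n)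
agree a {m<n} = mk⇔ (λ _ → toWitness m<n) (λ _ → a)

disagree : ∀ {A : Set} {m n} → ¬ A → {_ : False (m <? n)} → A ⇔ (m < n)
disagree ¬a {m≮n} = mk⇔ (⊥-elim ∘ ¬a) (⊥-elim ∘ toWitnessFalse m≮n)

module _ {v₁ v₂ v₃ : ℕ} (v₁<v₂ : v₁ < v₂) (v₂<v₃ : v₂ < v₃) where

  private
    v₁<v₃ = <-trans v₁<v₂ v₂<v₃

  occurrence-132 : Contains (v₁ ∷ v₃ ∷ v₂ ∷ []) (1 ∷ 3 ∷ 2 ∷ [])
  occurrence-132 = (λ a → a) , (λ _ _ a<b → a<b) , iso
    where
    iso : ∀ a b → (lookup (v₁ ∷ v₃ ∷ v₂ ∷ []) a < lookup (v₁ ∷ v₃ ∷ v₂ ∷ []) b)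
                  ⇔ (lookup (1 ∷ 3 ∷ 2 ∷ []) a < lookup (1 ∷ 3 ∷ 2 ∷ []) b)
    iso zero             zero             = disagree (<-irrefl refl)
    iso zero             (suc zero)       = agree v₁<v₃
    iso zero             (suc (suc zero)) = agree v₁<v₂
    iso (suc zero)       zero             = disagree (<-asym v₁<v₃)
    iso (suc zero)       (suc zero)       = disagree (<-irrefl refl)
    iso (suc zero)       (suc (suc zero)) = disagree (<-asym v₂<v₃)
    iso (suc (suc zero)) zero             = disagree (<-asym v₁<v₂)
    iso (suc (suc zero)) (suc zero)       = agree v₂<v₃
    iso (suc (suc zero)) (suc (suc zero)) = disagree (<-irrefl refl)

  module _ {v₄ : ℕ} (v₃<v₄ : v₃ < v₄) where

    private
      v₂<v₄ = <-trans v₂<v₃ v₃<v₄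
      v₁<v₄ = <-trans v₁<v₂ v₂<v₄

    occurrence-2341 : Contains (v₂ ∷ v₃ ∷ v₄ ∷ v₁ ∷ []) (2 ∷ 3 ∷ 4 ∷ 1 ∷ [])
    occurrence-2341 = (λ a → a) , (λ _ _ a<b → a<b) , iso
      where
      iso : ∀ a b → (lookup (v₂ ∷ v₃ ∷ v₄ ∷ v₁ ∷ []) a < lookup (v₂ ∷ v₃ ∷ v₄ ∷ v₁ ∷ []) b)
                    ⇔ (lookup (2 ∷ 3 ∷ 4 ∷ 1 ∷ []) a < lookup (2 ∷ 3 ∷ 4 ∷ 1 ∷ []) b)
      iso zero                   zero                   = disagree (<-irrefl refl)
      iso zero                   (suc zero)             = agree v₂<v₃
      iso zero                   (suc (suc zero))       = agree v₂<v₄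
      iso zero                   (suc (suc (suc zero))) = disagree (<-asym v₁<v₂)
      iso (suc zero)             zero                   = disagree (<-asym v₂<v₃)
      iso (suc zero)             (suc zero)             = disagree (<-irrefl refl)
      iso (suc zero)             (suc (suc zero))       = agree v₃<v₄
      iso (suc zero)             (suc (suc (suc zero))) = disagree (<-asym v₁<v₃)
      iso (suc (suc zero))       zero                   = disagree (<-asym v₂<v₄)
      iso (suc (suc zero))       (suc zero)             = disagree (<-asym v₃<v₄)
      iso (suc (suc zero))       (suc (suc zero))       = disagree (<-irrefl refl)
      iso (suc (suc zero))       (suc (suc (suc zero))) = disagree (<-asym v₁<v₄)
      iso (suc (suc (suc zero))) zero                   = agree v₁<v₂
      iso (suc (suc (suc zero))) (suc zero)             = agree v₁<v₃
      iso (suc (suc (suc zero))) (suc (suc zero))       = agree v₁<v₄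
      iso (suc (suc (suc zero))) (suc (suc (suc zero))) = disagree (<-irrefl refl)

    occurrence-3241 : Contains (v₃ ∷ v₂ ∷ v₄ ∷ v₁ ∷ []) (3 ∷ 2 ∷ 4 ∷ 1 ∷ [])
    occurrence-3241 = (λ a → a) , (λ _ _ a<b → a<b) , iso
      where
      iso : ∀ a b → (lookup (v₃ ∷ v₂ ∷ v₄ ∷ v₁ ∷ []) a < lookup (v₃ ∷ v₂ ∷ v₄ ∷ v₁ ∷ []) b)
                    ⇔ (lookup (3 ∷ 2 ∷ 4 ∷ 1 ∷ []) a < lookup (3 ∷ 2 ∷ 4 ∷ 1 ∷ []) b)
      iso zero                   zero                   = disagree (<-irrefl refl)
      iso zero                   (suc zero)             = disagree (<-asym v₂<v₃)
      iso zero                   (suc (suc zero))       = agree v₃<v₄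
      iso zero                   (suc (suc (suc zero))) = disagree (<-asym v₁<v₃)
      iso (suc zero)             zero                   = agree v₂<v₃
      iso (suc zero)             (suc zero)             = disagree (<-irrefl refl)
      iso (suc zero)             (suc (suc zero))       = agree v₂<v₄
      iso (suc zero)             (suc (suc (suc zero))) = disagree (<-asym v₁<v₂)
      iso (suc (suc zero))       zero                   = disagree (<-asym v₃<v₄)
      iso (suc (suc zero))       (suc zero)             = disagree (<-asym v₂<v₄)
      iso (suc (suc zero))       (suc (suc zero))       = disagree (<-irrefl refl)
      iso (suc (suc zero))       (suc (suc (suc zero))) = disagree (<-asym v₁<v₄)
      iso (suc (suc (suc zero))) zero                   = agree v₁<v₃
      iso (suc (suc (suc zero))) (suc zero)             = agree v₁<v₂
      iso (suc (suc (suc zero))) (suc (suc zero))       = agree v₁<v₄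
      iso (suc (suc (suc zero))) (suc (suc (suc zero))) = disagree (<-irrefl refl)

Av-132-2341-3241 : List ℕ → Set
Av-132-2341-3241 π =
  Avoids π (1 ∷ 3 ∷ 2 ∷ []) × Avoids π (2 ∷ 3 ∷ 4 ∷ 1 ∷ []) × Avoids π (3 ∷ 2 ∷ 4 ∷ 1 ∷ [])

Av-⊆ : σ ⊆ π → Av-132-2341-3241 π → Av-132-2341-3241 σ
Av-⊆ τ (av₁ , av₂ , av₃) =
  Avoids-⊆ {p = 1 ∷ 3 ∷ 2 ∷ []} τ av₁ ,
  Avoids-⊆ {p = 2 ∷ 3 ∷ 4 ∷ 1 ∷ []} τ av₂ ,
  Avoids-⊆ {p = 3 ∷ 2 ∷ 4 ∷ 1 ∷ []} τ av₃

Av-∷-max : All (_< x) σ → Av-132-2341-3241 σ → Av-132-2341-3241 (x ∷ σ)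
Av-∷-max σ<x (av₁ , av₂ , av₃) =
  Avoids-∷-max (suc zero) σ<x (from-yes (1 <? 3)) av₁ ,
  Avoids-∷-max (suc zero) σ<x (from-yes (2 <? 3)) av₂ ,
  Avoids-∷-max (suc (suc zero)) σ<x (from-yes (3 <? 4)) av₃

Av-∷-∷-max : All (_< x) σ → All (_< y) σ → Av-132-2341-3241 σ → Av-132-2341-3241 (x ∷ y ∷ σ)
Av-∷-∷-max {x} {σ} {y} σ<x σ<y av =
  let (av₁ , av₂ , av₃) = Av-∷-max σ<y av
  in  third-exceeds-first (from-yes (1 <? 2)) av₁ ,
      third-exceeds-first (from-yes (2 <? 4)) av₂ ,
      third-exceeds-first (from-yes (3 <? 4)) av₃
  where
  third-exceeds-first : ∀ {q r s qs} → q < s →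
                        Avoids (y ∷ σ) (q ∷ r ∷ s ∷ qs) → Avoids (x ∷ y ∷ σ) (q ∷ r ∷ s ∷ qs)
  third-exceeds-first = Avoids-∷-max-but-next (suc zero) (suc (suc zero)) σ<x z<s (from-yes (1 <? 2))

Av-∷ʳ-max : All (_< x) σ → Av-132-2341-3241 σ → Av-132-2341-3241 (σ ++ [ x ])
Av-∷ʳ-max σ<x (av₁ , av₂ , av₃) =
  Avoids-∷ʳ-max {q = 2} {qs = 1 ∷ 3 ∷ []} (suc zero) σ<x (from-yes (2 <? 3)) av₁ ,
  Avoids-∷ʳ-max {q = 1} {qs = 2 ∷ 3 ∷ 4 ∷ []} zero σ<x (from-yes (1 <? 2)) av₂ ,
  Avoids-∷ʳ-max {q = 1} {qs = 3 ∷ 2 ∷ 4 ∷ []} zero σ<x (from-yes (1 <? 3)) av₃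

Unique-⊆ : xs ⊆ ys → Unique ys → Unique xs
Unique-⊆ []         []              = []
Unique-⊆ (y ∷ʳ τ)   (_ ∷ unique)    = Unique-⊆ τ unique
Unique-⊆ (refl ∷ τ) (y≢ys ∷ unique) = All-resp-⊆ τ y≢ys ∷ Unique-⊆ τ unique

range-suc-↭ : ∀ n → map suc (upTo (suc n)) ↭ suc n ∷ map suc (upTo n)
range-suc-↭ n =
  subst (_↭ suc n ∷ map suc (upTo n)) range-∷ʳ (↭-sym (∷↭∷ʳ (suc n) (map suc (upTo n))))
  where
  range-∷ʳ : map suc (upTo n) ++ [ suc n ] ≡ map suc (upTo (suc n))
  range-∷ʳ = trans (sym (map-++ suc (upTo n) [ n ])) (cong (map suc) (upTo-∷ʳ n))

IsPerm-All-≤ : IsPerm n π → All (_≤ n) π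
IsPerm-All-≤ π↭ = All.tabulate λ x∈π → case ∈-map⁻ suc (∈-resp-↭ π↭ x∈π) of λ where
  (_ , i∈ , refl) → ∈-upTo⁻ i∈

IsPerm-∋ : IsPerm n π → m < n → suc m ∈ π
IsPerm-∋ π↭ m<n = ∈-resp-↭ (↭-sym π↭) (∈-map⁺ suc (∈-upTo⁺ m<n))

IsPerm-Unique : IsPerm n π → Unique π
IsPerm-Unique {n} π↭ = Unique-resp-↭ (↭⇒↭ₛ (↭-sym π↭)) (map⁺ suc-injective (upTo⁺ n))

IsPerm-∷ : IsPerm n σ → IsPerm (suc n) (suc n ∷ σ)
IsPerm-∷ {n} σ↭ = ↭-trans (↭-prep (suc n) σ↭) (↭-sym (range-suc-↭ n))

IsPerm-∷⁻ : IsPerm (suc n) (suc n ∷ σ) → IsPerm n σ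
IsPerm-∷⁻ {n} π↭ = drop-∷ (↭-trans π↭ (range-suc-↭ n))

IsPerm-∷ʳ : IsPerm n σ → IsPerm (suc n) (σ ++ [ suc n ])
IsPerm-∷ʳ {n} {σ} σ↭ = ↭-trans (↭-sym (∷↭∷ʳ (suc n) σ)) (IsPerm-∷ σ↭)

IsPerm-∷ʳ⁻ : IsPerm (suc n) (σ ++ [ suc n ]) → IsPerm n σ
IsPerm-∷ʳ⁻ {n} {σ} π↭ = IsPerm-∷⁻ (↭-trans (∷↭∷ʳ (suc n) σ) π↭)

IsPerm-∷-∷ : IsPerm n σ → IsPerm (suc (suc n)) (suc n ∷ suc (suc n) ∷ σ)
IsPerm-∷-∷ σ↭ = ↭-trans (↭-swap _ _ ↭-refl) (IsPerm-∷ (IsPerm-∷ σ↭))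

IsPerm-∷-∷⁻ : IsPerm (suc (suc n)) (suc n ∷ suc (suc n) ∷ σ) → IsPerm n σ
IsPerm-∷-∷⁻ π↭ = IsPerm-∷⁻ (IsPerm-∷⁻ (↭-trans (↭-swap _ _ ↭-refl) π↭))

¬Av-max-at-third : ∀ {x y z} → All (_≤ m) (x ∷ y ∷ m ∷ z ∷ []) → Unique (x ∷ y ∷ m ∷ z ∷ []) →
                   ¬ Av-132-2341-3241 (x ∷ y ∷ m ∷ z ∷ [])
¬Av-max-at-third {m} {x} {y} {z} (x≤m ∷ y≤m ∷ _ ∷ z≤m ∷ [])
  ((x≢y ∷ x≢m ∷ x≢z ∷ []) ∷ (y≢m ∷ y≢z ∷ []) ∷ (m≢z ∷ []) ∷ [] ∷ []) (av₁ , av₂ , av₃) =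
  by-order (<-cmp x z) (<-cmp y z) (<-cmp x y)
  where
  x<m = ≤∧≢⇒< x≤m x≢m
  y<m = ≤∧≢⇒< y≤m y≢m
  z<m = ≤∧≢⇒< z≤m (m≢z ∘ sym)
  by-order : Tri (x < z) (x ≡ z) (z < x) → Tri (y < z) (y ≡ z) (z < y) →
             Tri (x < y) (x ≡ y) (y < x) → ⊥
  by-order (tri< x<z _ _) _              _              =
    av₁ (Contains-⊆ (refl ∷ y ∷ʳ ⊆-refl) (occurrence-132 x<z z<m))
  by-order (tri≈ _ x≡z _) _              _              = x≢z x≡z
  by-order _              (tri< y<z _ _) _              =
    av₁ (Contains-⊆ (x ∷ʳ ⊆-refl) (occurrence-132 y<z z<m))
  by-order _              (tri≈ _ y≡z _) _              = y≢z y≡z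
  by-order _              _              (tri≈ _ x≡y _) = x≢y x≡y
  by-order (tri> _ _ z<x) (tri> _ _ z<y) (tri< x<y _ _) = av₂ (occurrence-2341 z<x x<y y<m)
  by-order (tri> _ _ z<x) (tri> _ _ z<y) (tri> _ _ y<x) = av₃ (occurrence-3241 z<y y<x x<m)

max-position : ∀ {n} π → P132 (suc n) π →
                 (Σ (List ℕ) λ τ → π ≡ suc n ∷ τ)
               ⊎ (Σ ℕ λ a → Σ (List ℕ) λ τ → π ≡ a ∷ suc n ∷ τ)
               ⊎ (Σ (List ℕ) λ τ → π ≡ τ ++ [ suc n ])
max-position π (π↭ , av) with ∈-∃++ (IsPerm-∋ π↭ ≤-refl)
... | []          , τ     , π≡ = inj₁ (τ , π≡)
... | a ∷ []      , τ     , π≡ = inj₂ (inj₁ (a , τ , π≡))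
... | u           , []    , π≡ = inj₂ (inj₂ (u , π≡))
... | x ∷ y ∷ u   , z ∷ v , refl =
  ⊥-elim (¬Av-max-at-third (All-resp-⊆ sub (IsPerm-All-≤ π↭)) (Unique-⊆ sub (IsPerm-Unique π↭))
                           (Av-⊆ sub av))
  where
  sub : x ∷ y ∷ _ ∷ z ∷ [] ⊆ π
  sub = refl ∷ refl ∷ ++⁺ˡ u (refl ∷ refl ∷ minimum v)

P132-∷-max : P132 n σ → P132 (suc n) (suc n ∷ σ)
P132-∷-max (σ↭ , av) = IsPerm-∷ σ↭ , Av-∷-max (All.map s≤s (IsPerm-All-≤ σ↭)) av

P132-∷-max⁻ : P132 (suc n) (suc n ∷ σ) → P132 n σ
P132-∷-max⁻ (π↭ , av) = IsPerm-∷⁻ π↭ , Av-⊆ (_ ∷ʳ ⊆-refl) av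

P132-∷-∷-max : P132 n σ → P132 (suc (suc n)) (suc n ∷ suc (suc n) ∷ σ)
P132-∷-∷-max (σ↭ , av) =
  IsPerm-∷-∷ σ↭ , Av-∷-∷-max (All.map s≤s σ≤n) (All.map (s≤s ∘ m≤n⇒m≤1+n) σ≤n) av
  where σ≤n = IsPerm-All-≤ σ↭

P132-∷-∷-max⁻ : P132 (suc (suc n)) (suc n ∷ suc (suc n) ∷ σ) → P132 n σ
P132-∷-∷-max⁻ (π↭ , av) = IsPerm-∷-∷⁻ π↭ , Av-⊆ (_ ∷ʳ _ ∷ʳ ⊆-refl) av

P132-∷ʳ-max : P132 n σ → P132 (suc n) (σ ++ [ suc n ])
P132-∷ʳ-max (σ↭ , av) = IsPerm-∷ʳ σ↭ , Av-∷ʳ-max (All.map s≤s (IsPerm-All-≤ σ↭)) av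

P132-∷ʳ-max⁻ : P132 (suc n) (σ ++ [ suc n ]) → P132 n σ
P132-∷ʳ-max⁻ {n} {σ} (π↭ , av) = IsPerm-∷ʳ⁻ π↭ , Av-⊆ {σ} {σ ++ [ suc n ]} (++⁺ʳ _ ⊆-refl) av

P132-second-max⇒first : ∀ {a τ} → P132 (suc (suc n)) (a ∷ suc (suc n) ∷ τ) → a ≡ suc n
P132-second-max⇒first {n} {a} {τ} (π↭ , av₁ , _) with a ≟ suc n
... | yes a≡n+1 = a≡n+1
... | no  a≢n+1 =
  ⊥-elim (av₁ (Contains-⊆ (refl ∷ refl ∷ from∈ (in-tail (IsPerm-∋ π↭ (m≤n⇒m≤1+n ≤-refl))))
                          (occurrence-132 a<n+1 ≤-refl)))
  where
  a<n+2 : a < suc (suc n)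
  a<n+2 = ≤∧≢⇒< (All.head (IsPerm-All-≤ π↭)) (All.head (AllPairs.head (IsPerm-Unique π↭)))
  a<n+1 : a < suc n
  a<n+1 = ≤∧≢⇒< (≤-pred a<n+2) a≢n+1
  in-tail : suc n ∈ a ∷ suc (suc n) ∷ τ → suc n ∈ τ
  in-tail (here n+1≡a)           = contradiction (sym n+1≡a) a≢n+1
  in-tail (there (here n+1≡n+2)) = ⊥-elim (<-irrefl n+1≡n+2 ≤-refl)
  in-tail (there (there n+1∈τ))  = n+1∈τ

prepend-max-bijection : ∀ n → BijOnto (P132 n) (λ π → P132 (suc n) π × Σ (List ℕ) λ τ → π ≡ suc n ∷ τ)
                                      (λ σ → suc n ∷ σ)
prepend-max-bijection n =
  (λ σ σ∈ → P132-∷-max σ∈ , σ , refl) ,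
  (λ _ _ _ _ → ∷-injectiveʳ) ,
  λ { _ (π∈ , τ , refl) → τ , P132-∷-max⁻ π∈ , refl }

prepend-two-max-bijection :
  ∀ n → BijOnto (P132 n)
                (λ π → P132 (suc (suc n)) π × Σ ℕ λ a → Σ (List ℕ) λ τ → π ≡ a ∷ suc (suc n) ∷ τ)
                (λ σ → suc n ∷ suc (suc n) ∷ σ)
prepend-two-max-bijection n =
  (λ σ σ∈ → P132-∷-∷-max σ∈ , suc n , σ , refl) ,
  (λ _ _ _ _ → ∷-injectiveʳ ∘ ∷-injectiveʳ) ,
  λ { _ (π∈ , a , τ , refl) →
        case P132-second-max⇒first π∈ of λ { refl → τ , P132-∷-∷-max⁻ π∈ , refl } }

append-max-bijection : ∀ n → BijOnto (P132 n) (λ π → P132 (suc n) π × Σ (List ℕ) λ τ → π ≡ τ ++ [ suc n ])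
                                     (λ σ → σ ++ [ suc n ])
append-max-bijection n =
  (λ σ σ∈ → P132-∷ʳ-max σ∈ , σ , refl) ,
  (λ σ σ′ _ _ → ∷ʳ-injectiveˡ σ σ′) ,
  λ { _ (π∈ , τ , refl) → τ , P132-∷ʳ-max⁻ π∈ , refl }

mainTheorem1 : ∀ (n : ℕ) → 3 ≤ n →
    (∀ (π : List ℕ) → P132 n π →
        (Σ (List ℕ) λ τ → π ≡ n ∷ τ)
      ⊎ (Σ ℕ λ a → Σ (List ℕ) λ τ → π ≡ a ∷ n ∷ τ)
      ⊎ (Σ (List ℕ) λ τ → π ≡ τ ++ (n ∷ [])))
    ×
    BijOnto (P132 (n ∸ 1))
            (λ π → P132 n π × Σ (List ℕ) λ τ → π ≡ n ∷ τ)
            (λ σ → n ∷ σ)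
    ×
    BijOnto (P132 (n ∸ 2))
            (λ π → P132 n π × Σ ℕ λ a → Σ (List ℕ) λ τ → π ≡ a ∷ n ∷ τ)
            (λ σ → (n ∸ 1) ∷ n ∷ σ)
    ×
    BijOnto (P132 (n ∸ 1))
            (λ π → P132 n π × Σ (List ℕ) λ τ → π ≡ τ ++ (n ∷ []))
            (λ σ → σ ++ (n ∷ []))
mainTheorem1 _ (s≤s (s≤s (s≤s {n = k} _))) =
  max-position ,
  prepend-max-bijection (2 + k) ,
  prepend-two-max-bijection (1 + k) ,
  append-max-bijection (2 + k)
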